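{- Let $(a_n)_{n=0}^\infty$ be a sequence of integers such that $a_0>0$, $a_1\ge 1$, $a_0\le a_1$, $a_n=a_{n-1}+a_{n-2}$ for all $n\ge 2$, and $a_0^2+a_1a_0-a_1^2>0$. Then for all $n\ge 0$, $$\frac{1}{a_{2n+3}}+\frac{1}{a_{2n+4}}-\frac{1}{a_{2n+2}}>0.$$ -}

module Defs where

open import Data.Nat using (ℕ; zero; suc)
open import Data.Integer using (ℤ; +_; -[1+_]; -_)
open import Data.Rational using (ℚ; _/_; 0ℚ)

-- Reciprocal of an integer as a rational number: inv x = 1/x for x ≠ 0.
-- (Convention inv 0 = 0; it is never used at 0 in the theorem, since the
-- hypotheses force all terms to be positive.)
inv : ℤ → ℚ
inv (+ zero)    = 0ℚ
inv (+ suc n)   = + 1 / suc n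
inv -[1+ n ]    = - (+ 1) / suc n

module Submission where

open import Defs
open import Data.Nat using (ℕ; suc; _+_; _*_)
open import Data.Nat.Properties using (*-comm; +-suc)
open import Data.Integer using (ℤ; +_; -[1+_]; +<+; positive) renaming (_+_ to _+ℤ_; _*_ to _*ℤ_; _-_ to _-ℤ_; -_ to -ℤ_; _<_ to _<ℤ_; _≤_ to _≤ℤ_)
open import Data.Integer.Properties using (neg-involutive; +-mono-<; <-≤-trans)
open import Data.Integer.Tactic.RingSolver using (solve-∀)
open import Data.Rational using (ℚ; 0ℚ; toℚᵘ) renaming (_+_ to _+ℚ_; _-_ to _-ℚ_; _<_ to _<ℚ_)
open import Data.Rational.Properties using (toℚᵘ-cancel-<; toℚᵘ-homo-+; toℚᵘ-homo‿-; toℚᵘ-fromℚᵘ)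
open import Data.Rational.Unnormalised using (ℚᵘ; ↥_; 0ℚᵘ) renaming (_/_ to _/ᵘ_; _+_ to _+ᵘ_; _-_ to _-ᵘ_; _<_ to _<ᵘ_; _≃_ to _≃ᵘ_)
open import Data.Rational.Unnormalised.Properties using (positive⁻¹; <-respʳ-≃; ≃-sym; ≃-trans; +-cong; -‿cong)
open import Relation.Binary.PropositionalEquality using (_≡_; refl; sym; trans; cong; subst; module ≡-Reasoning)

-- With D k = a_k² + a_{k+1} a_k − a_{k+1}², the recurrence gives D (k+1) = − D k, so D is
-- 2-periodic and D (2n+2) = D 0 > 0.  With x = a_{2n+2} and y = a_{2n+3} all terms are
-- positive, and 1/y + 1/(x+y) − 1/x = (x² + yx − y²) / (xy(x+y)) has numerator D (2n+2).

discriminant : ℤ → ℤ → ℤ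
discriminant x y = (x *ℤ x +ℤ y *ℤ x) -ℤ y *ℤ y

discriminant-step : ∀ x y → discriminant y (y +ℤ x) ≡ -ℤ discriminant x y
discriminant-step = expanded
  where
  expanded : ∀ x y → (y *ℤ y +ℤ (y +ℤ x) *ℤ y) -ℤ (y +ℤ x) *ℤ (y +ℤ x) ≡ -ℤ ((x *ℤ x +ℤ y *ℤ x) -ℤ y *ℤ y)
  expanded = solve-∀

reciprocal-excessᵘ : ℕ → ℕ → ℚᵘ
reciprocal-excessᵘ x y = ((+ 1 /ᵘ suc y) +ᵘ (+ 1 /ᵘ (suc y + suc x))) -ᵘ (+ 1 /ᵘ suc x)

↥-reciprocal-excessᵘ : ∀ x y → ↥ reciprocal-excessᵘ x y ≡ discriminant (+ suc x) (+ suc y)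
↥-reciprocal-excessᵘ x y = identity (+ suc x) (+ suc y)
  where
  -- the left-hand side is the numerator exactly as ℚᵘ's _+_ and -_ compute it
  identity : ∀ X Y → (+ 1 *ℤ (Y +ℤ X) +ℤ + 1 *ℤ Y) *ℤ X +ℤ (-ℤ + 1) *ℤ (Y *ℤ (Y +ℤ X))
                   ≡ (X *ℤ X +ℤ Y *ℤ X) -ℤ Y *ℤ Y
  identity = solve-∀

reciprocal-excessᵘ-positive : ∀ x y → + 0 <ℤ discriminant (+ suc x) (+ suc y) → 0ℚᵘ <ᵘ reciprocal-excessᵘ x y
reciprocal-excessᵘ-positive x y D>0 =
  positive⁻¹ (reciprocal-excessᵘ x y) {{positive (subst (+ 0 <ℤ_) (sym (↥-reciprocal-excessᵘ x y)) D>0)}}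

toℚᵘ-inv : ∀ n → toℚᵘ (inv (+ suc n)) ≃ᵘ + 1 /ᵘ suc n
toℚᵘ-inv n = toℚᵘ-fromℚᵘ (+ 1 /ᵘ suc n)

inv-excess-positive : ∀ {x y} → + 0 <ℤ x → + 0 <ℤ y → + 0 <ℤ discriminant x y →
  0ℚ <ℚ (inv y +ℚ inv (y +ℤ x)) -ℚ inv x
inv-excess-positive {+ suc x} {+ suc y} _ _ D>0 =
  toℚᵘ-cancel-< (<-respʳ-≃ (≃-sym toℚᵘ-excess) (reciprocal-excessᵘ-positive x y D>0))
  where
  y⁻¹ z⁻¹ x⁻¹ : ℚ
  y⁻¹ = inv (+ suc y)
  z⁻¹ = inv (+ suc y +ℤ + suc x)
  x⁻¹ = inv (+ suc x)
  toℚᵘ-excess : toℚᵘ ((y⁻¹ +ℚ z⁻¹) -ℚ x⁻¹) ≃ᵘ reciprocal-excessᵘ x y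
  toℚᵘ-excess =
    ≃-trans (toℚᵘ-homo-+ (y⁻¹ +ℚ z⁻¹) _)
      (+-cong (≃-trans (toℚᵘ-homo-+ y⁻¹ z⁻¹) (+-cong (toℚᵘ-inv y) (toℚᵘ-inv (y + suc x))))
              (≃-trans (toℚᵘ-homo‿- x⁻¹) (-‿cong (toℚᵘ-inv x))))
inv-excess-positive {+ 0}      (+<+ ())
inv-excess-positive { -[1+ _ ]} ()
inv-excess-positive {+ suc _} {+ 0}      _ (+<+ ())
inv-excess-positive {+ suc _} { -[1+ _ ]} _ ()

module FibonacciLike (a : ℕ → ℤ) (rec : ∀ n → a (suc (suc n)) ≡ a (suc n) +ℤ a n) where

  discriminantAt : ℕ → ℤ
  discriminantAt k = discriminant (a k) (a (suc k))

  discriminantAt-suc : ∀ k → discriminantAt (suc k) ≡ -ℤ discriminantAt k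
  discriminantAt-suc k rewrite rec k = discriminant-step (a k) (a (suc k))

  discriminantAt-periodic : ∀ m k → discriminantAt (m * 2 + k) ≡ discriminantAt k
  discriminantAt-periodic 0       k = refl
  discriminantAt-periodic (suc m) k = begin
    discriminantAt (suc (suc (m * 2 + k)))  ≡⟨ discriminantAt-suc (suc (m * 2 + k)) ⟩
    -ℤ discriminantAt (suc (m * 2 + k))     ≡⟨ cong -ℤ_ (discriminantAt-suc (m * 2 + k)) ⟩
    -ℤ -ℤ discriminantAt (m * 2 + k)        ≡⟨ neg-involutive _ ⟩
    discriminantAt (m * 2 + k)              ≡⟨ discriminantAt-periodic m k ⟩
    discriminantAt k                        ∎
    where open ≡-Reasoning

  positive-terms : + 0 <ℤ a 0 → + 0 <ℤ a 1 → ∀ k → + 0 <ℤ a k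
  positive-terms a₀>0 a₁>0 0 = a₀>0
  positive-terms a₀>0 a₁>0 1 = a₁>0
  positive-terms a₀>0 a₁>0 (suc (suc k)) = subst (+ 0 <ℤ_) (sym (rec k))
    (+-mono-< (positive-terms a₀>0 a₁>0 (suc k)) (positive-terms a₀>0 a₁>0 k))

  inv-excess-positiveAt : (∀ k → + 0 <ℤ a k) → ∀ k → + 0 <ℤ discriminantAt k →
    0ℚ <ℚ (inv (a (suc k)) +ℚ inv (a (suc (suc k)))) -ℚ inv (a k)
  inv-excess-positiveAt pos k D>0 rewrite rec k = inv-excess-positive (pos k) (pos (suc k)) D>0

corollary2p5 : (a : ℕ → ℤ) →
    + 0 <ℤ a 0 → + 1 ≤ℤ a 1 → a 0 ≤ℤ a 1 →
    (∀ n → a (suc (suc n)) ≡ a (suc n) +ℤ a n) →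
    + 0 <ℤ (a 0 *ℤ a 0 +ℤ a 1 *ℤ a 0) -ℤ a 1 *ℤ a 1 →
    ∀ n → 0ℚ <ℚ (inv (a (2 * n + 3)) +ℚ inv (a (2 * n + 4))) -ℚ inv (a (2 * n + 2))
corollary2p5 a a₀>0 _ a₀≤a₁ rec D₀>0 n
  rewrite *-comm 2 n | +-suc (n * 2) 3 | +-suc (n * 2) 2 =
    inv-excess-positiveAt (positive-terms a₀>0 (<-≤-trans a₀>0 a₀≤a₁)) (n * 2 + 2) D>0
  where
  open FibonacciLike a rec
  D>0 : + 0 <ℤ discriminantAt (n * 2 + 2)
  D>0 = subst (+ 0 <ℤ_) (sym (trans (discriminantAt-periodic n 2) (discriminantAt-periodic 1 0))) D₀>0
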